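{- Let $G=(V,E)$ be a simple connected graph with $n$ vertices and $m\geq 1$ edges such that $\sum_{e_{uv}\in E}(d_u+d_v)=4m$. Then $G$ is either a cycle (of any order) or a tree whose maximum degree is $\Delta=3$ and which has a unique vertex of degree $3$. In the latter case, $n\geq 4$.
   Context: $d_u$ denotes the degree of vertex $u$ and $e_{uv}$ the edge with endpoints $u,v$. -}

module Defs where

open import Data.Nat using (ℕ; zero; suc; _+_; _≤_)
open import Data.Fin using (Fin; toℕ; _<?_)
import Data.Fin as F
open import Data.Bool using (Bool; true; false; if_then_else_)
open import Data.Product using (Σ; _×_; ∃-syntax)
open import Data.Sum using (_⊎_)
open import Relation.Binary.PropositionalEquality using (_≡_)
open import Relation.Nullary using (¬_; does)
open import Function.Bundles using (_↔_; Inverse)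
open import Function.Definitions using (Injective)

record Graph (n : ℕ) : Set where
  field
    adj     : Fin n → Fin n → Bool
    sym     : ∀ u v → adj u v ≡ adj v u
    irrefl  : ∀ u → adj u u ≡ false
open Graph public

∑ : ∀ {n} → (Fin n → ℕ) → ℕ
∑ {zero}  f = 0
∑ {suc n} f = f F.zero + ∑ (λ i → f (F.suc i))

deg : ∀ {n} → Graph n → Fin n → ℕ
deg G u = ∑ (λ v → if adj G u v then 1 else 0)

-- Each edge e_uv counted once, as the pair (u,v) with u < v
isEdge< : ∀ {n} → Graph n → Fin n → Fin n → Bool
isEdge< G u v = if does (u <? v) then adj G u v else false

edgeCount : ∀ {n} → Graph n → ℕ
edgeCount G = ∑ (λ u → ∑ (λ v → if isEdge< G u v then 1 else 0))

edgeDegSum : ∀ {n} → Graph n → ℕ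
edgeDegSum G = ∑ (λ u → ∑ (λ v → if isEdge< G u v then deg G u + deg G v else 0))

data Reach {n} (G : Graph n) : Fin n → Fin n → Set where
  here : ∀ {u} → Reach G u u
  step : ∀ {u v w} → adj G u v ≡ true → Reach G v w → Reach G u w

Connected : ∀ {n} → Graph n → Set
Connected G = ∀ u v → Reach G u v

-- adjacency of the cycle C_k on Fin k (i ~ i+1 mod k)
CycAdj : (k : ℕ) → Fin k → Fin k → Set
CycAdj k i j =
  (suc (toℕ i) ≡ toℕ j) ⊎ (suc (toℕ j) ≡ toℕ i)
  ⊎ ((toℕ i ≡ 0 × suc (toℕ j) ≡ k) ⊎ (toℕ j ≡ 0 × suc (toℕ i) ≡ k))

IsCycle : ∀ {n} → Graph n → Set
IsCycle {n} G = 3 ≤ n × Σ (Fin n ↔ Fin n) (λ σ →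
  ∀ i j → (adj G (Inverse.to σ i) (Inverse.to σ j) ≡ true → CycAdj n i j)
        × (CycAdj n i j → adj G (Inverse.to σ i) (Inverse.to σ j) ≡ true))

HasCycle : ∀ {n} → Graph n → Set
HasCycle {n} G = Σ ℕ (λ k → Σ (Fin (3 + k) → Fin n) (λ f →
  Injective _≡_ _≡_ f × (∀ i j → CycAdj (3 + k) i j → adj G (f i) (f j) ≡ true)))

IsTree : ∀ {n} → Graph n → Set
IsTree G = Connected G × ¬ HasCycle G

MaxDegree3 : ∀ {n} → Graph n → Set
MaxDegree3 G = (∀ u → deg G u ≤ 3) × (∃[ u ] deg G u ≡ 3)

UniqueDeg3 : ∀ {n} → Graph n → Set
UniqueDeg3 G = ∃[ u ] (deg G u ≡ 3 × (∀ v → deg G v ≡ 3 → v ≡ u))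

{-# OPTIONS --safe #-}

-- Double counting gives ∑ d_u = 2m and
-- ∑_{uv ∈ E} (d_u + d_v) = ∑ d_u², so the hypothesis says ∑ d_u² = 4m. In a connected
-- graph with an edge every d_u ≥ 1, and summing d² + 2 = 3d + (d − 1)(d − 2) over the
-- vertices gives 2n = 2m + E with E = ∑ (d_u − 1)(d_u − 2) ≥ 0. Connectivity also gives
-- n ≤ m + 1 (grow a vertex set along crossing edges), so either n = m and E = 0, or
-- n = m + 1 and E = 2. In the first case every degree is at most 2 and the degrees sum
-- to 2n, so G is connected and 2-regular, hence a cycle: a non-backtracking walk first
-- repeats a vertex at its start, and then its vertices are closed under adjacency.
-- In the second case exactly one vertex has degree 3 and the others degree at most 2;
-- G is acyclic because deleting an edge of a cycle keeps G connected with m − 1 edges,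
-- so n ≤ m; and 2n − 2 = ∑ d_u ≥ (n − 1) + 3 gives n ≥ 4.

module Submission where

open import Defs hiding (sym)

open import Data.Bool using (Bool; true; false; if_then_else_; _∧_; _∨_; not)
open import Data.Bool.Properties
  using (∧-conicalˡ; ∧-conicalʳ; ∧-zeroʳ; ∨-zeroʳ; ∨-identityʳ; ¬-not) renaming (_≟_ to _≟ᵇ_)
open import Data.Fin using (Fin; toℕ; punchIn; punchOut)
import Data.Fin as F
import Data.Fin.Properties as FP
open import Data.Nat using (ℕ; zero; suc; _+_; _*_; _∸_; _≤_; _<_; z≤n; s≤s)
open import Data.Nat.Properties
open import Algebra.Properties.CommutativeSemigroup +-commutativeSemigroup using (interchange; xy∙z≈xz∙y)
import Algebra.Properties.Semiring.Sum +-*-semiring as Sum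
open import Data.Nat.Solver using (module +-*-Solver)
open import Data.Product using (_×_; _,_; proj₁; proj₂; ∃-syntax)
import Data.Product
open import Data.Sum using (_⊎_; inj₁; inj₂; [_,_])
import Data.Sum
open import Data.Vec.Functional using (removeAt)
open import Function using (_∘_)
open import Function.Bundles using (mk⇔; _↔_; mk↔ₛ′)
open import Relation.Binary.Definitions using (tri<; tri≈; tri>)
open import Relation.Binary.PropositionalEquality
  using (_≡_; _≢_; refl; sym; trans; cong; cong₂; subst; subst₂; module ≡-Reasoning)
open import Relation.Nullary using (¬_; contradiction; Dec; does; yes; no; _×-dec_; _⊎-dec_)
open import Relation.Nullary.Decidable using (dec-true; dec-false; does-⇔)

∑≡sum : ∀ {n} (f : Fin n → ℕ) → ∑ f ≡ Sum.sum f
∑≡sum {zero}  f = refl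
∑≡sum {suc n} f = cong (f F.zero +_) (∑≡sum (f ∘ F.suc))

∑-cong : ∀ {n} {f g : Fin n → ℕ} → (∀ i → f i ≡ g i) → ∑ f ≡ ∑ g
∑-cong {f = f} {g} f≗g = begin
  ∑ f         ≡⟨ ∑≡sum f ⟩
  Sum.sum f   ≡⟨ Sum.sum-cong-≗ {x = f} {y = g} f≗g ⟩
  Sum.sum g   ≡⟨ ∑≡sum g ⟨
  ∑ g         ∎
  where open ≡-Reasoning

∑-distrib-+ : ∀ {n} (f g : Fin n → ℕ) → ∑ (λ i → f i + g i) ≡ ∑ f + ∑ g
∑-distrib-+ f g = begin
  ∑ (λ i → f i + g i)          ≡⟨ ∑≡sum (λ i → f i + g i) ⟩
  Sum.sum (λ i → f i + g i)    ≡⟨ Sum.∑-distrib-+ f g ⟩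
  Sum.sum f + Sum.sum g        ≡⟨ cong₂ _+_ (∑≡sum f) (∑≡sum g) ⟨
  ∑ f + ∑ g                    ∎
  where open ≡-Reasoning

∑-comm : ∀ {m n} (f : Fin m → Fin n → ℕ) → ∑ (λ i → ∑ (f i)) ≡ ∑ (λ j → ∑ (λ i → f i j))
∑-comm f = begin
  ∑ (λ i → ∑ (f i))                        ≡⟨ ∑∑≡sumsum f ⟩
  Sum.sum (λ i → Sum.sum (f i))            ≡⟨ Sum.∑-comm f ⟩
  Sum.sum (λ j → Sum.sum (λ i → f i j))    ≡⟨ ∑∑≡sumsum (λ j i → f i j) ⟨
  ∑ (λ j → ∑ (λ i → f i j))                ∎
  where
  open ≡-Reasoning
  ∑∑≡sumsum : ∀ {m n} (g : Fin m → Fin n → ℕ) → ∑ (∑ ∘ g) ≡ Sum.sum (Sum.sum ∘ g)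
  ∑∑≡sumsum g = trans (∑-cong (∑≡sum ∘ g)) (∑≡sum (Sum.sum ∘ g))

*-distribˡ-∑ : ∀ {n} c (f : Fin n → ℕ) → c * ∑ f ≡ ∑ (λ i → c * f i)
*-distribˡ-∑ c f = begin
  c * ∑ f                    ≡⟨ cong (c *_) (∑≡sum f) ⟩
  c * Sum.sum f              ≡⟨ Sum.*-distribˡ-sum c f ⟩
  Sum.sum (λ i → c * f i)    ≡⟨ ∑≡sum (λ i → c * f i) ⟨
  ∑ (λ i → c * f i)          ∎
  where open ≡-Reasoning

∑-remove : ∀ {n} (f : Fin (suc n) → ℕ) i → ∑ f ≡ f i + ∑ (removeAt f i)
∑-remove f i = begin
  ∑ f                             ≡⟨ ∑≡sum f ⟩
  Sum.sum f                       ≡⟨ Sum.sum-remove f ⟩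
  f i + Sum.sum (removeAt f i)    ≡⟨ cong (f i +_) (∑≡sum (removeAt f i)) ⟨
  f i + ∑ (removeAt f i)          ∎
  where open ≡-Reasoning

∑-const : ∀ {n} c → ∑ {n} (λ _ → c) ≡ n * c
∑-const {zero}  c = refl
∑-const {suc n} c = cong (c +_) (∑-const {n} c)

∑-mono-≤ : ∀ {n} {f g : Fin n → ℕ} → (∀ i → f i ≤ g i) → ∑ f ≤ ∑ g
∑-mono-≤ {zero}  f≤g = z≤n
∑-mono-≤ {suc n} f≤g = +-mono-≤ (f≤g F.zero) (∑-mono-≤ (f≤g ∘ F.suc))

removeAt-punchOut : ∀ {n} (f : Fin (suc n) → ℕ) {x y} (x≢y : x ≢ y) → removeAt f x (punchOut x≢y) ≡ f y
removeAt-punchOut f x≢y = cong f (FP.punchIn-punchOut x≢y)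

∑-mono-≤-gap : ∀ {n} {f g : Fin n → ℕ} {k} → (∀ i → f i ≤ g i) → ∀ x → f x + k ≤ g x → ∑ f + k ≤ ∑ g
∑-mono-≤-gap {suc n} {f} {g} {k} f≤g x gap = begin
  ∑ f + k                           ≡⟨ cong (_+ k) (∑-remove f x) ⟩
  f x + ∑ (removeAt f x) + k        ≡⟨ xy∙z≈xz∙y (f x) _ k ⟩
  f x + k + ∑ (removeAt f x)        ≤⟨ +-mono-≤ gap (∑-mono-≤ (f≤g ∘ punchIn x)) ⟩
  g x + ∑ (removeAt g x)            ≡⟨ ∑-remove g x ⟨
  ∑ g                               ∎
  where open ≤-Reasoning

∑-mono-≤-gap₂ : ∀ {n} {f g : Fin n → ℕ} {k l} → (∀ i → f i ≤ g i) → ∀ {x y} → x ≢ y →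
                f x + k ≤ g x → f y + l ≤ g y → ∑ f + (k + l) ≤ ∑ g
∑-mono-≤-gap₂ {suc n} {f} {g} {k} {l} f≤g {x} {y} x≢y gapx gapy = begin
  ∑ f + (k + l)                          ≡⟨ cong (_+ (k + l)) (∑-remove f x) ⟩
  f x + ∑ (removeAt f x) + (k + l)       ≡⟨ interchange (f x) _ k l ⟩
  f x + k + (∑ (removeAt f x) + l)       ≤⟨ +-mono-≤ gapx (∑-mono-≤-gap (f≤g ∘ punchIn x) (punchOut x≢y) gapy′) ⟩
  g x + ∑ (removeAt g x)                 ≡⟨ ∑-remove g x ⟨
  ∑ g                                    ∎
  where
  open ≤-Reasoning
  gapy′ : removeAt f x (punchOut x≢y) + l ≤ removeAt g x (punchOut x≢y)
  gapy′ = subst₂ (λ a b → a + l ≤ b) (sym (removeAt-punchOut f x≢y)) (sym (removeAt-punchOut g x≢y)) gapy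

∑-mono-≤-tight : ∀ {n} {f g : Fin n → ℕ} → (∀ i → f i ≤ g i) → ∑ f ≡ ∑ g → ∀ i → f i ≡ g i
∑-mono-≤-tight {f = f} {g} f≤g ∑f≡∑g i with m≤n⇒m<n∨m≡n (f≤g i)
... | inj₂ fi≡gi = fi≡gi
... | inj₁ fi<gi = contradiction (subst (_≤ ∑ g) (+-comm (∑ f) 1) ∑f<∑g) (<-irrefl ∑f≡∑g)
  where
  ∑f<∑g : ∑ f + 1 ≤ ∑ g
  ∑f<∑g = ∑-mono-≤-gap f≤g i (subst (_≤ g i) (+-comm 1 (f i)) fi<gi)

term≤∑ : ∀ {n} (f : Fin n → ℕ) x → f x ≤ ∑ f
term≤∑ {suc n} f x = subst (f x ≤_) (sym (∑-remove f x)) (m≤m+n (f x) _)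

pair≤∑ : ∀ {n} (f : Fin n → ℕ) {x y} → x ≢ y → f x + f y ≤ ∑ f
pair≤∑ {suc n} f {x} {y} x≢y = begin
  f x + f y                ≡⟨ cong (f x +_) (removeAt-punchOut f x≢y) ⟨
  f x + removeAt f x _     ≤⟨ +-monoʳ-≤ (f x) (term≤∑ (removeAt f x) (punchOut x≢y)) ⟩
  f x + ∑ (removeAt f x)   ≡⟨ ∑-remove f x ⟨
  ∑ f                      ∎
  where open ≤-Reasoning

triple≤∑ : ∀ {n} (f : Fin n → ℕ) {x y z} → x ≢ y → x ≢ z → y ≢ z → f x + (f y + f z) ≤ ∑ f
triple≤∑ {suc n} f {x} {y} {z} x≢y x≢z y≢z = begin
  f x + (f y + f z)                              ≡⟨ cong (f x +_) (cong₂ _+_ (removeAt-punchOut f x≢y) (removeAt-punchOut f x≢z)) ⟨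
  f x + (removeAt f x y′ + removeAt f x z′)      ≤⟨ +-monoʳ-≤ (f x) (pair≤∑ (removeAt f x) y′≢z′) ⟩
  f x + ∑ (removeAt f x)                         ≡⟨ ∑-remove f x ⟨
  ∑ f                                            ∎
  where
  open ≤-Reasoning
  y′ z′ : Fin n
  y′ = punchOut x≢y
  z′ = punchOut x≢z
  y′≢z′ : y′ ≢ z′
  y′≢z′ = y≢z ∘ FP.punchOut-injective x≢y x≢z

∑-pos⇒∃-pos : ∀ {n} (f : Fin n → ℕ) → 0 < ∑ f → ∃[ i ] 0 < f i
∑-pos⇒∃-pos {suc n} f 0<∑f with f F.zero in f0≡
... | suc _ = F.zero , subst (0 <_) (sym f0≡) (s≤s z≤n)
... | zero  with ∑-pos⇒∃-pos (f ∘ F.suc) 0<∑f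
...   | i , 0<fi = F.suc i , 0<fi

term<∑⇒∃other-pos : ∀ {n} (f : Fin n → ℕ) y → f y < ∑ f → ∃[ z ] z ≢ y × 0 < f z
term<∑⇒∃other-pos {suc n} f y fy<∑f with ∑-pos⇒∃-pos (removeAt f y) 0<rest
  where
  0<rest : 0 < ∑ (removeAt f y)
  0<rest = +-cancelˡ-< (f y) 0 _ (subst₂ _<_ (sym (+-identityʳ (f y))) (∑-remove f y) fy<∑f)
... | j , 0<fj = punchIn y j , FP.punchInᵢ≢i y j , 0<fj

𝟙 : Bool → ℕ
𝟙 b = if b then 1 else 0

𝟙-mono : ∀ {x y} → (x ≡ true → y ≡ true) → 𝟙 x ≤ 𝟙 y
𝟙-mono {false} x⇒y = z≤n
𝟙-mono {true}  x⇒y rewrite x⇒y refl = ≤-refl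

𝟙-true : ∀ {b} → b ≡ true → 𝟙 b ≡ 1
𝟙-true refl = refl

𝟙-pos : ∀ {b} → 0 < 𝟙 b → b ≡ true
𝟙-pos {true} _ = refl

∧∧-intro : ∀ {x y z} → x ≡ true → y ≡ true → z ≡ true → x ∧ (y ∧ z) ≡ true
∧∧-intro refl refl refl = refl

card : ∀ {n} → (Fin n → Bool) → ℕ
card S = ∑ (𝟙 ∘ S)

insert : ∀ {n} → (Fin n → Bool) → Fin n → Fin n → Bool
insert S b u = S u ∨ does (u FP.≟ b)

insert-⊇ : ∀ {n} (S : Fin n → Bool) b {u} → S u ≡ true → insert S b u ≡ true
insert-⊇ S b Su rewrite Su = refl

insert-∋ : ∀ {n} (S : Fin n → Bool) b → insert S b b ≡ true
insert-∋ S b rewrite dec-true (b FP.≟ b) refl = ∨-zeroʳ (S b)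

card-insert : ∀ {n} (S : Fin n → Bool) b → card (insert S b) ≤ suc (card S)
card-insert {suc n} S b = begin
  card (insert S b)                                  ≡⟨ ∑-remove (𝟙 ∘ insert S b) b ⟩
  𝟙 (insert S b b) + ∑ (removeAt (𝟙 ∘ insert S b) b) ≡⟨ cong₂ _+_ (cong 𝟙 (insert-∋ S b)) (∑-cong outside-b) ⟩
  1 + ∑ (removeAt (𝟙 ∘ S) b)                         ≤⟨ +-monoʳ-≤ 1 (m≤n+m _ (𝟙 (S b))) ⟩
  1 + (𝟙 (S b) + ∑ (removeAt (𝟙 ∘ S) b))             ≡⟨ cong suc (∑-remove (𝟙 ∘ S) b) ⟨
  suc (card S)                                       ∎
  where
  open ≤-Reasoning
  outside-b : ∀ j → 𝟙 (insert S b (punchIn b j)) ≡ 𝟙 (S (punchIn b j))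
  outside-b j rewrite dec-false (punchIn b j FP.≟ b) (FP.punchInᵢ≢i b j) = cong 𝟙 (∨-identityʳ _)

card<⇒∃∉ : ∀ {n} (S : Fin n → Bool) → card S < n → ∃[ w ] S w ≡ false
card<⇒∃∉ {n} S card<n = Data.Product.map₂ ¬-not (FP.¬∀⟶∃¬ n (λ w → S w ≡ true) (λ w → S w ≟ᵇ true) full⇒)
  where
  full⇒ : ¬ (∀ w → S w ≡ true)
  full⇒ full = <⇒≱ card<n (begin
    n              ≡⟨ *-identityʳ n ⟨
    n * 1          ≡⟨ ∑-const {n} 1 ⟨
    ∑ {n} (λ _ → 1) ≤⟨ ∑-mono-≤ (λ w → 𝟙-mono (λ _ → full w)) ⟩
    card S         ∎)
    where open ≤-Reasoning

pairCount : ∀ {n} → (Fin n → Fin n → Bool) → ℕ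
pairCount R = ∑ λ u → ∑ λ v → 𝟙 (R u v)

pairCount-mono : ∀ {n} {R R′ : Fin n → Fin n → Bool} →
                 (∀ u v → R u v ≡ true → R′ u v ≡ true) → pairCount R ≤ pairCount R′
pairCount-mono R⊆R′ = ∑-mono-≤ λ u → ∑-mono-≤ λ v → 𝟙-mono (R⊆R′ u v)

pairCount-mono-gap₂ : ∀ {n} {R R′ : Fin n → Fin n → Bool} →
                      (∀ u v → R u v ≡ true → R′ u v ≡ true) → ∀ {a b} → a ≢ b →
                      R a b ≡ false → R b a ≡ false → R′ a b ≡ true → R′ b a ≡ true →
                      pairCount R + 2 ≤ pairCount R′
pairCount-mono-gap₂ {R = R} {R′} R⊆R′ {a} {b} a≢b ¬Rab ¬Rba R′ab R′ba =
  ∑-mono-≤-gap₂ (λ u → ∑-mono-≤ λ v → 𝟙-mono (R⊆R′ u v)) a≢b (gap ¬Rab R′ab) (gap ¬Rba R′ba)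
  where
  gap : ∀ {u v} → R u v ≡ false → R′ u v ≡ true → ∑ (λ w → 𝟙 (R u w)) + 1 ≤ ∑ (λ w → 𝟙 (R′ u w))
  gap {u} {v} ¬Ruv R′uv = ∑-mono-≤-gap (λ w → 𝟙-mono (R⊆R′ u w)) v
    (subst₂ (λ x y → 𝟙 x + 1 ≤ 𝟙 y) (sym ¬Ruv) (sym R′uv) ≤-refl)

module _ {n} (G : Graph n) where

  adj-sym : ∀ {u v} → adj G u v ≡ true → adj G v u ≡ true
  adj-sym {u} {v} uv = trans (Graph.sym G v u) uv

  adj⇒≢ : ∀ {u v} → adj G u v ≡ true → u ≢ v
  adj⇒≢ {u} uu refl = contradiction (trans (sym uu) (irrefl G u)) λ ()

  Reach-trans : ∀ {u v w} → Reach G u v → Reach G v w → Reach G u w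
  Reach-trans here         q = q
  Reach-trans (step uv p)  q = step uv (Reach-trans p q)

  Reach-sym : ∀ {u v} → Reach G u v → Reach G v u
  Reach-sym here        = here
  Reach-sym (step uv p) = Reach-trans (Reach-sym p) (step (adj-sym uv) here)

  Reach-closed : (P : Fin n → Set) → (∀ {x y} → P x → adj G x y ≡ true → P y) →
                 ∀ {u w} → Reach G u w → P u → P w
  Reach-closed P closed here        Pu = Pu
  Reach-closed P closed (step uv p) Pu = Reach-closed P closed p (closed Pu uv)

  Reach-exit : (S : Fin n → Bool) → ∀ {u w} → Reach G u w → S u ≡ true → S w ≡ false →
               ∃[ a ] ∃[ b ] S a ≡ true × S b ≡ false × adj G a b ≡ true
  Reach-exit S here Su Sw = contradiction (trans (sym Su) Sw) λ ()
  Reach-exit S (step {u} {v} uv p) Su Sw with S v in Sv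
  ... | true  = Reach-exit S p Sv Sw
  ... | false = u , v , Su , Sv , uv

  ∑adj ∑edge : (Fin n → Fin n → ℕ) → ℕ
  ∑adj  w = ∑ λ u → ∑ λ v → if adj G u v then w u v else 0
  ∑edge w = ∑ λ u → ∑ λ v → if isEdge< G u v then w u v else 0

  ∑adj≡2*∑edge : (w : Fin n → Fin n → ℕ) → (∀ u v → w u v ≡ w v u) → ∑adj w ≡ 2 * ∑edge w
  ∑adj≡2*∑edge w w-sym = begin
    ∑adj w                                    ≡⟨ ∑-cong (λ u → ∑-cong (split u)) ⟩
    ∑ (λ u → ∑ λ v → edge u v + edge v u)     ≡⟨ ∑-cong (λ u → ∑-distrib-+ (edge u) (λ v → edge v u)) ⟩
    ∑ (λ u → ∑ (edge u) + ∑ λ v → edge v u)   ≡⟨ ∑-distrib-+ (∑ ∘ edge) (λ u → ∑ λ v → edge v u) ⟩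
    ∑edge w + ∑ (λ u → ∑ λ v → edge v u)      ≡⟨ cong (∑edge w +_) (∑-comm (λ v u → edge v u)) ⟨
    ∑edge w + ∑edge w                         ≡⟨ cong (∑edge w +_) (+-identityʳ (∑edge w)) ⟨
    2 * ∑edge w                               ∎
    where
    open ≡-Reasoning
    edge : Fin n → Fin n → ℕ
    edge u v = if isEdge< G u v then w u v else 0
    split : ∀ u v → (if adj G u v then w u v else 0) ≡ edge u v + edge v u
    split u v with FP.<-cmp u v
    ... | tri< u<v _ v≮u rewrite dec-true (u F.<? v) u<v | dec-false (v F.<? u) v≮u = sym (+-identityʳ _)
    ... | tri≈ _ refl _ rewrite dec-false (u F.<? u) (FP.<-irrefl refl) | irrefl G u = refl
    ... | tri> u≮v _ v<u rewrite dec-false (u F.<? v) u≮v | dec-true (v F.<? u) v<u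
                               | Graph.sym G u v | w-sym u v = refl

  handshake : ∑ (deg G) ≡ 2 * edgeCount G
  handshake = ∑adj≡2*∑edge (λ _ _ → 1) (λ _ _ → refl)

  ∑adj-weight : (f : Fin n → ℕ) → ∑ (λ u → ∑ λ v → if adj G u v then f u else 0) ≡ ∑ (λ u → f u * deg G u)
  ∑adj-weight f = ∑-cong λ u → trans (∑-cong (λ v → ifAdj u v)) (sym (*-distribˡ-∑ (f u) (𝟙 ∘ adj G u)))
    where
    ifAdj : ∀ u v → (if adj G u v then f u else 0) ≡ f u * 𝟙 (adj G u v)
    ifAdj u v with adj G u v
    ... | true  = sym (*-identityʳ (f u))
    ... | false = sym (*-zeroʳ (f u))

  edgeDegSum≡∑deg² : edgeDegSum G ≡ ∑ (λ u → deg G u * deg G u)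
  edgeDegSum≡∑deg² = *-cancelˡ-≡ _ _ 2 (begin
    2 * edgeDegSum G                          ≡⟨ ∑adj≡2*∑edge (λ u v → d u + d v) (λ u v → +-comm (d u) (d v)) ⟨
    ∑adj (λ u v → d u + d v)                  ≡⟨ ∑-cong (λ u → ∑-cong (if-+ u)) ⟩
    ∑ (λ u → ∑ λ v → tail u v + head u v)     ≡⟨ ∑-cong (λ u → ∑-distrib-+ (tail u) (head u)) ⟩
    ∑ (λ u → ∑ (tail u) + ∑ (head u))         ≡⟨ ∑-distrib-+ (∑ ∘ tail) (∑ ∘ head) ⟩
    X + ∑ (λ u → ∑ (head u))                  ≡⟨ cong (X +_) (∑-comm head) ⟩
    X + ∑ (λ v → ∑ λ u → head u v)            ≡⟨ cong (X +_) (∑-cong λ v → ∑-cong λ u → head≡tail u v) ⟩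
    X + X                                     ≡⟨ cong (X +_) (+-identityʳ X) ⟨
    2 * X                                     ≡⟨ cong (2 *_) (∑adj-weight d) ⟩
    2 * ∑ (λ u → d u * d u)                   ∎)
    where
    open ≡-Reasoning
    d : Fin n → ℕ
    d = deg G
    tail head : Fin n → Fin n → ℕ
    tail u v = if adj G u v then d u else 0
    head u v = if adj G u v then d v else 0
    X : ℕ
    X = ∑ (∑ ∘ tail)
    if-+ : ∀ u v → (if adj G u v then d u + d v else 0) ≡ tail u v + head u v
    if-+ u v with adj G u v
    ... | true  = refl
    ... | false = refl
    head≡tail : ∀ u v → head u v ≡ tail v u
    head≡tail u v = cong (λ b → if b then d v else 0) (Graph.sym G u v)

  adj⇒0<deg : ∀ {u v} → adj G u v ≡ true → 0 < deg G u
  adj⇒0<deg {u} {v} uv = subst (_≤ deg G u) (𝟙-true uv) (term≤∑ (𝟙 ∘ adj G u) v)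

  0<deg⇒∃adj : ∀ {u} → 0 < deg G u → ∃[ v ] adj G u v ≡ true
  0<deg⇒∃adj {u} 0<du = Data.Product.map₂ 𝟙-pos (∑-pos⇒∃-pos (𝟙 ∘ adj G u) 0<du)

  connected⇒0<deg : Connected G → 0 < edgeCount G → ∀ u → 0 < deg G u
  connected⇒0<deg conn 0<m u with ∑-pos⇒∃-pos (deg G) (subst (0 <_) (sym handshake) (*-monoʳ-< 2 0<m))
  ... | r , 0<dr with conn u r
  ...   | here      = 0<dr
  ...   | step ux _ = adj⇒0<deg ux

  deg≡2⇒another-adj : ∀ {x y} → deg G x ≡ 2 → adj G x y ≡ true → ∃[ z ] adj G x z ≡ true × z ≢ y
  deg≡2⇒another-adj {x} {y} dx≡2 xy with term<∑⇒∃other-pos (𝟙 ∘ adj G x) y 𝟙xy<dx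
    where
    𝟙xy<dx : 𝟙 (adj G x y) < deg G x
    𝟙xy<dx = subst₂ _<_ (sym (𝟙-true xy)) (sym dx≡2) (s≤s (s≤s z≤n))
  ... | z , z≢y , 0<xz = z , 𝟙-pos 0<xz , z≢y

  deg≡2⇒adj-either : ∀ {x y z w} → deg G x ≡ 2 → y ≢ z →
                     adj G x y ≡ true → adj G x z ≡ true → adj G x w ≡ true → w ≡ y ⊎ w ≡ z
  deg≡2⇒adj-either {x} {y} {z} {w} dx≡2 y≢z xy xz xw with w FP.≟ y | w FP.≟ z
  ... | yes w≡y | _       = inj₁ w≡y
  ... | no _    | yes w≡z = inj₂ w≡z
  ... | no w≢y  | no w≢z  = contradiction 3≤dx (subst (λ d → ¬ 3 ≤ d) (sym dx≡2) λ { (s≤s (s≤s ())) })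
    where
    3≤dx : 3 ≤ deg G x
    3≤dx = subst (_≤ deg G x) (cong₂ _+_ (𝟙-true xw) (cong₂ _+_ (𝟙-true xy) (𝟙-true xz)))
                 (triple≤∑ (𝟙 ∘ adj G x) w≢y w≢z y≢z)

-- A connected graph has at least n − 1 edges, and at least n if it has a cycle

module _ {n} (G : Graph n) where

  adjWithin : (Fin n → Bool) → Fin n → Fin n → Bool
  adjWithin S u v = S u ∧ (S v ∧ adj G u v)

  pairsWithin : (Fin n → Bool) → ℕ
  pairsWithin S = pairCount (adjWithin S)

  pairsWithin≤∑deg : ∀ S → pairsWithin S ≤ ∑ (deg G)
  pairsWithin≤∑deg S = pairCount-mono {R = adjWithin S} {R′ = adj G} λ u v e → ∧-conicalʳ (S v) _ (∧-conicalʳ (S u) _ e)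

  pairsWithin-insert : ∀ S {a b} → S a ≡ true → S b ≡ false → adj G a b ≡ true →
                       pairsWithin S + 2 ≤ pairsWithin (insert S b)
  pairsWithin-insert S {a} {b} Sa Sb ab =
    pairCount-mono-gap₂ {R = adjWithin S} {R′ = adjWithin (insert S b)} ⊆insert a≢b ¬ab ¬ba
    (∧∧-intro (insert-⊇ S b Sa) (insert-∋ S b) ab) (∧∧-intro (insert-∋ S b) (insert-⊇ S b Sa) (adj-sym G ab))
    where
    ⊆insert : ∀ u v → adjWithin S u v ≡ true → adjWithin (insert S b) u v ≡ true
    ⊆insert u v e = ∧∧-intro (insert-⊇ S b (∧-conicalˡ (S u) _ e)) (insert-⊇ S b (∧-conicalˡ (S v) _ e′))
                             (∧-conicalʳ (S v) _ e′)
      where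
      e′ : S v ∧ adj G u v ≡ true
      e′ = ∧-conicalʳ (S u) _ e
    a≢b : a ≢ b
    a≢b refl = contradiction (trans (sym Sa) Sb) λ ()
    ¬ab : S a ∧ (S b ∧ adj G a b) ≡ false
    ¬ab rewrite Sb = ∧-zeroʳ (S a)
    ¬ba : S b ∧ (S a ∧ adj G b a) ≡ false
    ¬ba rewrite Sb = refl

  grow-set : Connected G → ∀ r k → suc k ≤ n → ∃[ S ] S r ≡ true × card S ≤ suc k × 2 * k ≤ pairsWithin S
  grow-set conn r zero _ = insert (λ _ → false) r , insert-∋ _ r , card≤1 , z≤n
    where
    card≤1 : card (insert (λ _ → false) r) ≤ 1
    card≤1 = subst (λ c → card (insert (λ _ → false) r) ≤ suc c) (trans (∑-const {n} 0) (*-zeroʳ n))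
                   (card-insert (λ _ → false) r)
  grow-set conn r (suc k) 2+k≤n with grow-set conn r k (≤-trans (n≤1+n (suc k)) 2+k≤n)
  ... | S , Sr , cardS≤ , 2k≤pairs with card<⇒∃∉ S (≤-trans (s≤s cardS≤) 2+k≤n)
  ... | w , Sw with Reach-exit G S (conn r w) Sr Sw
  ... | a , b , Sa , Sb , ab = insert S b , insert-⊇ S b Sr , ≤-trans (card-insert S b) (s≤s cardS≤) , (begin
    2 * suc k                  ≡⟨ trans (*-suc 2 k) (+-comm 2 (2 * k)) ⟩
    2 * k + 2                  ≤⟨ +-monoˡ-≤ 2 2k≤pairs ⟩
    pairsWithin S + 2          ≤⟨ pairsWithin-insert S Sa Sb ab ⟩
    pairsWithin (insert S b)   ∎)
    where open ≤-Reasoning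

connected⇒n≤1+m : ∀ {n} (G : Graph n) → Connected G → n ≤ suc (edgeCount G)
connected⇒n≤1+m {zero}  G conn = z≤n
connected⇒n≤1+m {suc n} G conn with grow-set G conn F.zero n ≤-refl
... | S , _ , _ , 2n≤pairs = *-cancelˡ-≤ 2 (begin
  2 * suc n              ≡⟨ trans (*-suc 2 n) (+-comm 2 (2 * n)) ⟩
  2 * n + 2              ≤⟨ +-monoˡ-≤ 2 (≤-trans 2n≤pairs (pairsWithin≤∑deg G S)) ⟩
  ∑ (deg G) + 2          ≡⟨ cong (_+ 2) (handshake G) ⟩
  2 * edgeCount G + 2    ≡⟨ trans (+-comm _ 2) (sym (*-suc 2 (edgeCount G))) ⟩
  2 * suc (edgeCount G)  ∎)
  where open ≤-Reasoning

Reach-along : ∀ {n} (G : Graph n) {l} (g : Fin (suc l) → Fin n) →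
              (∀ i → adj G (g (F.inject₁ i)) (g (F.suc i)) ≡ true) → Reach G (g F.zero) (g (F.fromℕ l))
Reach-along G {zero}  g g-adj = here
Reach-along G {suc l} g g-adj = step (g-adj F.zero) (Reach-along G (g ∘ F.suc) (g-adj ∘ F.suc))

module _ {n} (G : Graph n) (a b : Fin n) where

  IsPair : Fin n → Fin n → Set
  IsPair u v = (u ≡ a × v ≡ b) ⊎ (u ≡ b × v ≡ a)

  isPair? : ∀ u v → Dec (IsPair u v)
  isPair? u v = (u FP.≟ a ×-dec v FP.≟ b) ⊎-dec (u FP.≟ b ×-dec v FP.≟ a)

  IsPair-swap : ∀ {u v} → IsPair u v → IsPair v u
  IsPair-swap = Data.Sum.swap ∘ Data.Sum.map Data.Product.swap Data.Product.swap

  isPair-sym : ∀ u v → does (isPair? u v) ≡ does (isPair? v u)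
  isPair-sym u v = does-⇔ (mk⇔ IsPair-swap IsPair-swap) (isPair? u v) (isPair? v u)

  deleteEdge : Graph n
  deleteEdge = record
    { adj    = λ u v → adj G u v ∧ not (does (isPair? u v))
    ; sym    = λ u v → cong₂ (λ x y → x ∧ not y) (Graph.sym G u v) (isPair-sym u v)
    ; irrefl = λ u → cong (_∧ _) (irrefl G u)
    }

  deleteEdge-⊆ : ∀ u v → adj deleteEdge u v ≡ true → adj G u v ≡ true
  deleteEdge-⊆ u v = ∧-conicalˡ (adj G u v) _

  deleteEdge-keeps : ∀ {u v} → adj G u v ≡ true → ¬ IsPair u v → adj deleteEdge u v ≡ true
  deleteEdge-keeps {u} {v} uv ¬pair rewrite uv | dec-false (isPair? u v) ¬pair = refl

  deleteEdge-removes : ∀ {u v} → IsPair u v → adj deleteEdge u v ≡ false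
  deleteEdge-removes {u} {v} pair rewrite dec-true (isPair? u v) pair = ∧-zeroʳ (adj G u v)

  deleteEdge-connected : Connected G → Reach deleteEdge a b → Connected deleteEdge
  deleteEdge-connected conn a⇝b u v = lift (conn u v)
    where
    lift : ∀ {u v} → Reach G u v → Reach deleteEdge u v
    lift here = here
    lift (step {u} {x} ux p) with isPair? u x
    ... | yes (inj₁ (refl , refl)) = Reach-trans deleteEdge a⇝b (lift p)
    ... | yes (inj₂ (refl , refl)) = Reach-trans deleteEdge (Reach-sym deleteEdge a⇝b) (lift p)
    ... | no ¬pair                 = step (deleteEdge-keeps ux ¬pair) (lift p)

  deleteEdge-edgeCount : adj G a b ≡ true → a ≢ b → suc (edgeCount deleteEdge) ≤ edgeCount G
  deleteEdge-edgeCount ab a≢b = *-cancelˡ-≤ 2 (begin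
    2 * suc (edgeCount deleteEdge)   ≡⟨ trans (*-suc 2 _) (+-comm 2 _) ⟩
    2 * edgeCount deleteEdge + 2     ≡⟨ cong (_+ 2) (handshake deleteEdge) ⟨
    ∑ (deg deleteEdge) + 2           ≤⟨ pairCount-mono-gap₂ {R = adj deleteEdge} {R′ = adj G} deleteEdge-⊆ a≢b
                                          (deleteEdge-removes (inj₁ (refl , refl))) (deleteEdge-removes (inj₂ (refl , refl)))
                                          ab (adj-sym G ab) ⟩
    ∑ (deg G)                        ≡⟨ handshake G ⟩
    2 * edgeCount G                  ∎)
    where open ≤-Reasoning

connected∧cyclic⇒n≤m : ∀ {n} (G : Graph n) → Connected G → HasCycle G → n ≤ edgeCount G
connected∧cyclic⇒n≤m {n} G conn (k , f , f-inj , f-adj) = begin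
  _                           ≤⟨ connected⇒n≤1+m G′ (deleteEdge-connected G a b conn a⇝b) ⟩
  suc (edgeCount G′)          ≤⟨ deleteEdge-edgeCount G a b ab (f≢f0 F.zero ∘ sym) ⟩
  edgeCount G                 ∎
  where
  open ≤-Reasoning
  a b : Fin n
  a = f F.zero
  b = f (F.suc F.zero)
  G′ : Graph n
  G′ = deleteEdge G a b
  ab : adj G a b ≡ true
  ab = f-adj F.zero (F.suc F.zero) (inj₁ refl)
  f≢f0 : ∀ i → f (F.suc i) ≢ a
  f≢f0 i e = FP.0≢1+n (sym (f-inj e))
  b⇝last : Reach G′ b (f (F.fromℕ (2 + k)))
  b⇝last = Reach-along G′ (f ∘ F.suc) λ i → deleteEdge-keeps G a b
    (f-adj _ _ (inj₁ (cong (suc ∘ suc) (FP.toℕ-inject₁ i))))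
    [ (λ (e , _) → f≢f0 _ e) , (λ (_ , e) → f≢f0 _ e) ]
  last→a : adj G′ (f (F.fromℕ (2 + k))) a ≡ true
  last→a = deleteEdge-keeps G a b
    (f-adj _ _ (inj₂ (inj₂ (inj₂ (refl , cong suc (FP.toℕ-fromℕ (2 + k)))))))
    [ (λ (e , _) → f≢f0 _ e) , (λ (e , _) → FP.0≢1+n (sym (FP.suc-injective (f-inj e)))) ]
  a⇝b : Reach G′ a b
  a⇝b = Reach-sym G′ (Reach-trans G′ b⇝last (step last→a here))

-- Connected 2-regular graphs are cycles

InjectiveBelow : ∀ {A : Set} → (ℕ → A) → ℕ → Set
InjectiveBelow p j = ∀ {a b} → a < j → b < j → p a ≡ p b → a ≡ b

injectiveBelow-suc : ∀ {A : Set} (p : ℕ → A) {j} → InjectiveBelow p j →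
                     (∀ {i} → i < j → p j ≢ p i) → InjectiveBelow p (suc j)
injectiveBelow-suc p inj fresh {a} {b} (s≤s a≤j) (s≤s b≤j) e with m≤n⇒m<n∨m≡n a≤j | m≤n⇒m<n∨m≡n b≤j
... | inj₁ a<j  | inj₁ b<j  = inj a<j b<j e
... | inj₂ refl | inj₂ refl = refl
... | inj₂ refl | inj₁ b<j  = contradiction e (fresh b<j)
... | inj₁ a<j  | inj₂ refl = contradiction (sym e) (fresh a<j)

injectiveBelow⇒≤ : ∀ {n j} (p : ℕ → Fin n) → InjectiveBelow p j → j ≤ n
injectiveBelow⇒≤ p inj = FP.injective⇒≤ {f = p ∘ toℕ} λ e → FP.toℕ-injective (inj (FP.toℕ<n _) (FP.toℕ<n _) e)

covering⇒≤ : ∀ {n j} (p : ℕ → Fin n) → (∀ w → ∃[ k ] k < j × p k ≡ w) → n ≤ j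
covering⇒≤ {n} {j} p cover = FP.injective⇒≤ {f = index} index-injective
  where
  index : Fin n → Fin j
  index w = F.fromℕ< (proj₁ (proj₂ (cover w)))
  index-injective : ∀ {v w} → index v ≡ index w → v ≡ w
  index-injective {v} {w} e = begin
    v                      ≡⟨ proj₂ (proj₂ (cover v)) ⟨
    p (proj₁ (cover v))    ≡⟨ cong p (trans (sym (FP.toℕ-fromℕ< _)) (trans (cong toℕ e) (FP.toℕ-fromℕ< _))) ⟩
    p (proj₁ (cover w))    ≡⟨ proj₂ (proj₂ (cover w)) ⟩
    w                      ∎
    where open ≡-Reasoning

module TwoRegular {n} (G : Graph n) (conn : Connected G) (2-regular : ∀ u → deg G u ≡ 2) (r : Fin n) where

  record Arc : Set where
    constructor arc
    field
      source target : Fin n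
      edge          : adj G source target ≡ true

  turn : Arc → Arc
  turn (arc u v uv) = arc v (proj₁ next) (proj₁ (proj₂ next))
    where
    next : ∃[ w ] adj G v w ≡ true × w ≢ u
    next = deg≡2⇒another-adj G (2-regular v) (adj-sym G uv)

  walk : ℕ → Arc
  walk zero    = arc r (proj₁ first) (proj₂ first)
    where
    first : ∃[ v ] adj G r v ≡ true
    first = 0<deg⇒∃adj G (subst (0 <_) (sym (2-regular r)) (s≤s z≤n))
  walk (suc i) = turn (walk i)

  p : ℕ → Fin n
  p = Arc.source ∘ walk

  p-adj : ∀ i → adj G (p i) (p (suc i)) ≡ true
  p-adj i = Arc.edge (walk i)

  p-nonbacktracking : ∀ i → p (2 + i) ≢ p i
  p-nonbacktracking i = proj₂ (proj₂ (deg≡2⇒another-adj G (2-regular (p (suc i))) (adj-sym G (p-adj i))))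

  p-adj-either : ∀ i {w} → adj G (p (suc i)) w ≡ true → w ≡ p i ⊎ w ≡ p (2 + i)
  p-adj-either i = deg≡2⇒adj-either G (2-regular _) (p-nonbacktracking i ∘ sym) (adj-sym G (p-adj i)) (p-adj (suc i))

  short-return : ∀ {j} → 0 < j → j < 3 → p j ≢ p 0
  short-return {1} _ _ = adj⇒≢ G (p-adj 0) ∘ sym
  short-return {2} _ _ = p-nonbacktracking 0
  short-return {suc (suc (suc _))} _ (s≤s (s≤s (s≤s ())))

  first-repeat-is-start : ∀ {i j} → InjectiveBelow p j → i < j → p j ≡ p i → i ≡ 0
  first-repeat-is-start {zero}          _   _         _ = refl
  first-repeat-is-start {suc i} {suc j} inj (s≤s i<j) e
    with p-adj-either i (subst (λ x → adj G x (p j) ≡ true) e (adj-sym G (p-adj j)))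
  ... | inj₁ pj≡pi  = contradiction (inj (n<1+n j) (<-trans (n<1+n i) (s≤s i<j)) pj≡pi) (>⇒≢ i<j)
  ... | inj₂ pj≡p2i with m≤n⇒m<n∨m≡n i<j
  ...   | inj₂ 1+i≡j = contradiction (trans pj≡p2i (cong (p ∘ suc) 1+i≡j)) (adj⇒≢ G (p-adj j))
  ...   | inj₁ 1+i<j = contradiction (subst (λ k → p (suc k) ≡ p (suc i)) (inj (n<1+n j) (s≤s 1+i<j) pj≡p2i) e)
                                     (p-nonbacktracking (suc i))

  closed-walk-covers : ∀ {j} → 3 ≤ j → InjectiveBelow p j → p j ≡ p 0 → ∀ w → ∃[ k ] k < j × p k ≡ w
  closed-walk-covers {suc j} (s≤s (s≤s (s≤s _))) inj pj≡p0 w =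
    Reach-closed G OnWalk closed (conn (p 0) w) (0 , s≤s z≤n , refl)
    where
    OnWalk : Fin n → Set
    OnWalk x = ∃[ k ] k < suc j × p k ≡ x
    p0~pj : adj G (p 0) (p j) ≡ true
    p0~pj = adj-sym G (subst (λ x → adj G (p j) x ≡ true) pj≡p0 (p-adj j))
    p1≢pj : p 1 ≢ p j
    p1≢pj e with inj (s≤s (s≤s z≤n)) (n<1+n j) e
    ... | ()
    closed : ∀ {x y} → OnWalk x → adj G x y ≡ true → OnWalk y
    closed (zero , _ , refl) xy with deg≡2⇒adj-either G (2-regular (p 0)) p1≢pj (p-adj 0) p0~pj xy
    ... | inj₁ y≡p1 = 1 , s≤s (s≤s z≤n) , sym y≡p1
    ... | inj₂ y≡pj = j , n<1+n j , sym y≡pj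
    closed (suc k , k<j , refl) xy with p-adj-either k xy
    ... | inj₁ y≡pk = k , <-trans (n<1+n k) k<j , sym y≡pk
    ... | inj₂ y≡p2k with m≤n⇒m<n∨m≡n k<j
    ...   | inj₁ 2+k<j = 2 + k , 2+k<j , sym y≡p2k
    ...   | inj₂ 2+k≡j = 0 , s≤s z≤n , sym (trans y≡p2k (trans (cong p 2+k≡j) pj≡p0))

  no-early-return : ∀ {j} → 0 < j → j < n → InjectiveBelow p j → p j ≢ p 0
  no-early-return {j} 0<j j<n inj pj≡p0 with j Data.Nat.<? 3
  ... | yes j<3 = short-return 0<j j<3 pj≡p0
  ... | no  j≮3 = <⇒≱ j<n (covering⇒≤ p (closed-walk-covers (≮⇒≥ j≮3) inj pj≡p0))

  injectiveBelow : ∀ j → j ≤ n → InjectiveBelow p j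
  injectiveBelow zero    _   ()
  injectiveBelow (suc j) j<n = injectiveBelow-suc p inj fresh
    where
    inj : InjectiveBelow p j
    inj = injectiveBelow j (<⇒≤ j<n)
    fresh : ∀ {i} → i < j → p j ≢ p i
    fresh i<j pj≡pi with first-repeat-is-start inj i<j pj≡pi
    ... | refl = no-early-return i<j j<n inj pj≡pi

  injectiveBelow-n : InjectiveBelow p n
  injectiveBelow-n = injectiveBelow n ≤-refl

  returns : p n ≡ p 0
  returns with FP.any? (λ (i : Fin n) → p n FP.≟ p (toℕ i))
  ... | yes (i , pn≡pi) = subst (λ k → p n ≡ p k) (first-repeat-is-start injectiveBelow-n (FP.toℕ<n i) pn≡pi) pn≡pi
  ... | no ∄ = contradiction (injectiveBelow⇒≤ p (injectiveBelow-suc p injectiveBelow-n fresh)) (<-irrefl refl)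
    where
    fresh : ∀ {i} → i < n → p n ≢ p i
    fresh i<n e = ∄ (F.fromℕ< i<n , subst (λ k → p n ≡ p k) (sym (FP.toℕ-fromℕ< i<n)) e)

  3≤n : 3 ≤ n
  3≤n with 3 Data.Nat.≤? n
  ... | yes 3≤n = 3≤n
  ... | no  3≰n = contradiction returns (short-return (≤-trans (s≤s z≤n) (FP.toℕ<n r)) (≰⇒> 3≰n))

  onWalk : ∀ w → ∃[ k ] k < n × p k ≡ w
  onWalk = closed-walk-covers 3≤n injectiveBelow-n returns

  σ : Fin n ↔ Fin n
  σ = mk↔ₛ′ (p ∘ toℕ) (λ w → F.fromℕ< (index<n w)) p∘index index∘p
    where
    index : Fin n → ℕ
    index w = proj₁ (onWalk w)
    index<n : ∀ w → index w < n
    index<n w = proj₁ (proj₂ (onWalk w))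
    p-index : ∀ w → p (index w) ≡ w
    p-index w = proj₂ (proj₂ (onWalk w))
    p∘index : ∀ w → p (toℕ (F.fromℕ< (index<n w))) ≡ w
    p∘index w = trans (cong p (FP.toℕ-fromℕ< (index<n w))) (p-index w)
    index∘p : ∀ i → F.fromℕ< (index<n (p (toℕ i))) ≡ i
    index∘p i = FP.toℕ-injective (trans (FP.toℕ-fromℕ< (index<n _))
                  (injectiveBelow-n (index<n _) (FP.toℕ<n i) (p-index _)))

  -- CycAdj n i j unfolds to Cyc (toℕ i) (toℕ j).
  Cyc : ℕ → ℕ → Set
  Cyc a b = (suc a ≡ b) ⊎ (suc b ≡ a) ⊎ ((a ≡ 0 × suc b ≡ n) ⊎ (b ≡ 0 × suc a ≡ n))

  Cyc-sym : ∀ {a b} → Cyc a b → Cyc b a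
  Cyc-sym (inj₁ e)               = inj₂ (inj₁ e)
  Cyc-sym (inj₂ (inj₁ e))        = inj₁ e
  Cyc-sym (inj₂ (inj₂ (inj₁ e))) = inj₂ (inj₂ (inj₂ e))
  Cyc-sym (inj₂ (inj₂ (inj₂ e))) = inj₂ (inj₂ (inj₁ e))

  wraps : ∀ {a} → suc a ≡ n → p (suc a) ≡ p 0
  wraps 1+a≡n = trans (cong p 1+a≡n) returns

  adj-p : ℕ → Fin n → Set
  adj-p a x = adj G (p a) x ≡ true

  Cyc⇒adj : ∀ {a b} → Cyc a b → adj G (p a) (p b) ≡ true
  Cyc⇒adj {a}     (inj₁ refl)                         = p-adj a
  Cyc⇒adj {_} {b} (inj₂ (inj₁ refl))                  = adj-sym G (p-adj b)
  Cyc⇒adj {_} {b} (inj₂ (inj₂ (inj₁ (refl , 1+b≡n)))) = adj-sym G (subst (adj-p b) (wraps 1+b≡n) (p-adj b))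
  Cyc⇒adj {a}     (inj₂ (inj₂ (inj₂ (refl , 1+a≡n)))) = subst (adj-p a) (wraps 1+a≡n) (p-adj a)

  adj⇒Cyc : ∀ {a b} → a < n → b < n → adj G (p a) (p b) ≡ true → Cyc a b
  adj⇒Cyc {zero}  {zero}  _   _   ab = contradiction refl (adj⇒≢ G ab)
  adj⇒Cyc {zero}  {suc b} a<n b<n ab = Cyc-sym (adj⇒Cyc b<n a<n (adj-sym G ab))
  adj⇒Cyc {suc a} {b}     a<n b<n ab with p-adj-either a ab
  ... | inj₁ pb≡pa  = inj₂ (inj₁ (cong suc (injectiveBelow-n b<n (<-trans (n<1+n a) a<n) pb≡pa)))
  ... | inj₂ pb≡p2a with m≤n⇒m<n∨m≡n a<n
  ...   | inj₁ 2+a<n = inj₁ (sym (injectiveBelow-n b<n 2+a<n pb≡p2a))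
  ...   | inj₂ 2+a≡n = inj₂ (inj₂ (inj₂ (b≡0 , 2+a≡n)))
    where
    b≡0 : b ≡ 0
    b≡0 = injectiveBelow-n b<n (≤-trans (s≤s z≤n) b<n) (trans pb≡p2a (wraps 2+a≡n))

  isCycle : IsCycle G
  isCycle = 3≤n , σ , λ i j → adj⇒Cyc (FP.toℕ<n i) (FP.toℕ<n j) , Cyc⇒adj

connected∧2-regular⇒IsCycle : ∀ {n} (G : Graph n) → 0 < n → Connected G → (∀ u → deg G u ≡ 2) → IsCycle G
connected∧2-regular⇒IsCycle G 0<n conn 2-regular = TwoRegular.isCycle G conn 2-regular (F.fromℕ< 0<n)

-- The degree excess (d − 1)(d − 2)

excess : ℕ → ℕ
excess d = (d ∸ 1) * (d ∸ 2)

square-excess : ∀ d → 0 < d → d * d + 2 ≡ 3 * d + excess d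
square-excess (suc zero)    _ = refl
square-excess (suc (suc j)) _ =
  solve 1 (λ j → (con 2 :+ j) :* (con 2 :+ j) :+ con 2 := con 3 :* (con 2 :+ j) :+ (con 1 :+ j) :* j) refl j
  where open +-*-Solver

excess≡0⇒≤2 : ∀ d → excess d ≡ 0 → d ≤ 2
excess≡0⇒≤2 zero                _ = z≤n
excess≡0⇒≤2 (suc zero)          _ = s≤s z≤n
excess≡0⇒≤2 (suc (suc zero))    _ = s≤s (s≤s z≤n)
excess≡0⇒≤2 (suc (suc (suc j))) ()

0<excess≤2⇒≡3 : ∀ d → 0 < excess d → excess d ≤ 2 → d ≡ 3
0<excess≤2⇒≡3 (suc (suc (suc zero)))    _ _                  = refl
0<excess≤2⇒≡3 (suc (suc (suc (suc j)))) _ (s≤s (s≤s ≤0)) = contradiction (≤-trans (m≤n+m _ j) ≤0) λ ()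

module _ {n} (f : Fin n → ℕ) where

  ∑excess≡0⇒≤2 : ∑ (excess ∘ f) ≡ 0 → ∀ i → f i ≤ 2
  ∑excess≡0⇒≤2 E≡0 i = excess≡0⇒≤2 (f i) (n≤0⇒n≡0 (subst (excess (f i) ≤_) E≡0 (term≤∑ (excess ∘ f) i)))

  ∑excess≡2⇒unique-3 : ∑ (excess ∘ f) ≡ 2 → ∃[ u ] f u ≡ 3 × (∀ v → v ≢ u → f v ≤ 2)
  ∑excess≡2⇒unique-3 E≡2 with ∑-pos⇒∃-pos (excess ∘ f) (subst (0 <_) (sym E≡2) (s≤s z≤n))
  ... | u , 0<eu = u , 0<excess≤2⇒≡3 (f u) 0<eu eu≤2 , others
    where
    eu≤2 : excess (f u) ≤ 2
    eu≤2 = subst (excess (f u) ≤_) E≡2 (term≤∑ (excess ∘ f) u)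
    others : ∀ v → v ≢ u → f v ≤ 2
    others v v≢u = excess≡0⇒≤2 (f v) (n≤0⇒n≡0 (+-cancelˡ-≤ 2 _ 0 (begin
      2 + excess (f v)                ≡⟨ cong (λ d → excess d + excess (f v)) (0<excess≤2⇒≡3 (f u) 0<eu eu≤2) ⟨
      excess (f u) + excess (f v)     ≤⟨ pair≤∑ (excess ∘ f) (v≢u ∘ sym) ⟩
      ∑ (excess ∘ f)                  ≡⟨ E≡2 ⟩
      2 + 0                           ∎)))
      where open ≤-Reasoning

module _ {n} (G : Graph n) where

  degree-excess-identity : (∀ u → 0 < deg G u) → edgeDegSum G ≡ 4 * edgeCount G →
                           2 * n ≡ 2 * edgeCount G + ∑ (excess ∘ deg G)
  degree-excess-identity 0<d hyp = +-cancelˡ-≡ (4 * m) _ _ (begin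
    4 * m + 2 * n                              ≡⟨ cong₂ _+_ (trans (sym hyp) (edgeDegSum≡∑deg² G)) 2n≡∑2 ⟩
    ∑ (λ u → d u * d u) + ∑ {n} (λ _ → 2)      ≡⟨ ∑-distrib-+ (λ u → d u * d u) (λ _ → 2) ⟨
    ∑ (λ u → d u * d u + 2)                    ≡⟨ ∑-cong (λ u → square-excess (d u) (0<d u)) ⟩
    ∑ (λ u → 3 * d u + excess (d u))           ≡⟨ ∑-distrib-+ (λ u → 3 * d u) (excess ∘ d) ⟩
    ∑ (λ u → 3 * d u) + E                      ≡⟨ cong (_+ E) (trans (cong (3 *_) (sym (handshake G))) (*-distribˡ-∑ 3 d)) ⟨
    3 * (2 * m) + E                            ≡⟨ cong (_+ E) (trans (sym (*-assoc 3 2 m)) (*-distribʳ-+ m 4 2)) ⟩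
    (4 * m + 2 * m) + E                        ≡⟨ +-assoc (4 * m) (2 * m) E ⟩
    4 * m + (2 * m + E)                        ∎)
    where
    open ≡-Reasoning
    m : ℕ
    m = edgeCount G
    d : Fin n → ℕ
    d = deg G
    E : ℕ
    E = ∑ (excess ∘ d)
    2n≡∑2 : 2 * n ≡ ∑ {n} (λ _ → 2)
    2n≡∑2 = trans (*-comm 2 n) (sym (∑-const {n} 2))

  ∑excess≡0⇒2-regular : ∑ (excess ∘ deg G) ≡ 0 → n ≡ edgeCount G → ∀ u → deg G u ≡ 2
  ∑excess≡0⇒2-regular E≡0 n≡m = ∑-mono-≤-tight (∑excess≡0⇒≤2 (deg G) E≡0) (begin
    ∑ (deg G)          ≡⟨ handshake G ⟩
    2 * edgeCount G    ≡⟨ cong (2 *_) n≡m ⟨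
    2 * n              ≡⟨ *-comm 2 n ⟩
    n * 2              ≡⟨ ∑-const {n} 2 ⟨
    ∑ {n} (λ _ → 2)    ∎)
    where open ≡-Reasoning

  ∑excess≡2⇒MaxDegree3×UniqueDeg3 : ∑ (excess ∘ deg G) ≡ 2 → MaxDegree3 G × UniqueDeg3 G
  ∑excess≡2⇒MaxDegree3×UniqueDeg3 E≡2 with ∑excess≡2⇒unique-3 (deg G) E≡2
  ... | u , du≡3 , others = (≤3 , u , du≡3) , u , du≡3 , unique
    where
    ≤3 : ∀ v → deg G v ≤ 3
    ≤3 v with v FP.≟ u
    ... | yes refl = ≤-reflexive du≡3
    ... | no  v≢u  = ≤-trans (others v v≢u) (n≤1+n 2)
    unique : ∀ v → deg G v ≡ 3 → v ≡ u
    unique v dv≡3 with v FP.≟ u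
    ... | yes v≡u = v≡u
    ... | no  v≢u = contradiction (others v v≢u) (subst (λ d → ¬ d ≤ 2) (sym dv≡3) λ { (s≤s (s≤s ())) })

  deg3∧n≡1+m⇒4≤n : (∀ u → 0 < deg G u) → ∃[ u ] deg G u ≡ 3 → n ≡ suc (edgeCount G) → 4 ≤ n
  deg3∧n≡1+m⇒4≤n 0<d (u , du≡3) n≡1+m = subst (4 ≤_) (sym n≡1+m) (s≤s (+-cancelˡ-≤ m 3 m (begin
    m + 3                  ≡⟨ +-suc m 2 ⟩
    suc m + 2              ≡⟨ cong (_+ 2) (trans (sym n≡1+m) (trans (sym (*-identityʳ n)) (sym (∑-const {n} 1)))) ⟩
    ∑ {n} (λ _ → 1) + 2    ≤⟨ ∑-mono-≤-gap 0<d u (≤-reflexive (sym du≡3)) ⟩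
    ∑ (deg G)              ≡⟨ handshake G ⟩
    2 * m                  ≡⟨ cong (m +_) (+-identityʳ m) ⟩
    m + m                  ∎)))
    where
    open ≤-Reasoning
    m : ℕ
    m = edgeCount G

2*n≡2*m+e⇒n≡m∨n≡1+m : ∀ {n m e} → 2 * n ≡ 2 * m + e → n ≤ suc m → (n ≡ m × e ≡ 0) ⊎ (n ≡ suc m × e ≡ 2)
2*n≡2*m+e⇒n≡m∨n≡1+m {n} {m} {e} eq n≤1+m with m≤n⇒m<n∨m≡n n≤1+m
... | inj₂ refl      = inj₂ (refl , sym (+-cancelˡ-≡ (2 * m) 2 e (trans 2m+2≡2[1+m] eq)))
  where
  2m+2≡2[1+m] : 2 * m + 2 ≡ 2 * suc m
  2m+2≡2[1+m] = trans (+-comm (2 * m) 2) (sym (*-suc 2 m))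
... | inj₁ (s≤s n≤m) = inj₁ (n≡m , sym (+-cancelˡ-≡ (2 * m) 0 e (trans (+-identityʳ (2 * m)) 2m≡2m+e)))
  where
  n≡m : n ≡ m
  n≡m = ≤-antisym n≤m (*-cancelˡ-≤ 2 (subst (2 * m ≤_) (sym eq) (m≤m+n (2 * m) e)))
  2m≡2m+e : 2 * m ≡ 2 * m + e
  2m≡2m+e = trans (cong (2 *_) (sym n≡m)) eq

lemma1 : (n : ℕ) (G : Graph n) → Connected G → 1 ≤ edgeCount G
    → edgeDegSum G ≡ 4 * edgeCount G
    → IsCycle G ⊎ (IsTree G × MaxDegree3 G × UniqueDeg3 G × 4 ≤ n)
lemma1 n G conn 0<m hyp =
  Data.Sum.map cycle tree (2*n≡2*m+e⇒n≡m∨n≡1+m (degree-excess-identity G 0<d hyp) (connected⇒n≤1+m G conn))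
  where
  m E : ℕ
  m = edgeCount G
  E = ∑ (excess ∘ deg G)
  0<d : ∀ u → 0 < deg G u
  0<d = connected⇒0<deg G conn 0<m
  cycle : n ≡ m × E ≡ 0 → IsCycle G
  cycle (n≡m , E≡0) = connected∧2-regular⇒IsCycle G (subst (0 <_) (sym n≡m) 0<m) conn (∑excess≡0⇒2-regular G E≡0 n≡m)
  tree : n ≡ suc m × E ≡ 2 → IsTree G × MaxDegree3 G × UniqueDeg3 G × 4 ≤ n
  tree (n≡1+m , E≡2) = (conn , acyclic) , maxDeg , uniqueDeg , deg3∧n≡1+m⇒4≤n G 0<d (proj₂ maxDeg) n≡1+m
    where
    acyclic : ¬ HasCycle G
    acyclic cyc = 1+n≰n (subst (_≤ m) n≡1+m (connected∧cyclic⇒n≤m G conn cyc))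
    maxDeg : MaxDegree3 G
    maxDeg = proj₁ (∑excess≡2⇒MaxDegree3×UniqueDeg3 G E≡2)
    uniqueDeg : UniqueDeg3 G
    uniqueDeg = proj₂ (∑excess≡2⇒MaxDegree3×UniqueDeg3 G E≡2)
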